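{- For every string $x$, the array $\mathsf{MEPal}_x$ can be encoded using $2|x|-2$ bits; that is, for each length $m \ge 1$ there is a map assigning to each string $x$ of length $m$ a bit string of length at most $2m-2$ such that $\mathsf{MEPal}_x$ is uniquely determined by this bit string (strings $x,y$ of length $m$ with the same encoding satisfy $\mathsf{MEPal}_x=\mathsf{MEPal}_y$).
   Context: Strings are 0-indexed: $x = x[0]\cdots x[m-1]$, and $x[i..j]$ denotes the factor from $i$ to $j$. An even-palindrome is a string of even length (possibly $0$) equal to its reversal. An even-palindromic factor $x[c-r..c+r-1]$ is said to be centered at $c$; it is the maximal even-palindrome centered at $c$ if $c-r=0$, or $c+r-1=m-1$, or $x[c-r-1]\ne x[c+r]$. $\mathsf{MEPal}_x$ is the array of length $m$ whose entry $c$ is the length of the maximal even-palindrome centered at $c$. -}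

module Defs where

open import Data.Nat using (ℕ; zero; suc; _+_; _*_; _∸_; _<?_)
open import Data.Fin using (toℕ)
open import Data.List using (List; []; _∷_)
open import Data.Vec using (Vec; toList; tabulate)
open import Data.Maybe using (Maybe; just; nothing)
open import Relation.Nullary using (yes; no)
open import Relation.Binary.Definitions using (DecidableEquality)

lookupM : {A : Set} → List A → ℕ → Maybe A
lookupM []       _       = nothing
lookupM (a ∷ as) zero    = just a
lookupM (a ∷ as) (suc i) = lookupM as i

-- radius r of the maximal even-palindrome x[c-r..c+r-1] centred at c:
-- starting from r, extend while c-r-1 ≥ 0, c+r ≤ m-1 and x[c-r-1] = x[c+r].
-- The fuel argument bounds the number of extensions (m suffices).
radius : {A : Set} → DecidableEquality A → List A → ℕ → ℕ → ℕ → ℕ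
radius _≟_ xs c r zero = r
radius _≟_ xs c r (suc k) with r <? c
... | no _ = r
... | yes _ with lookupM xs (c ∸ suc r) | lookupM xs (c + r)
...   | just a | just b with a ≟ b
...     | yes _ = radius _≟_ xs c (suc r) k
...     | no _  = r
radius _≟_ xs c r (suc k) | yes _ | _ | _ = r

MEPal : {A : Set} → DecidableEquality A → {m : ℕ} → Vec A m → Vec ℕ m
MEPal _≟_ {m} x = tabulate (λ c → 2 * radius _≟_ (toList x) (toℕ c) 0 m)

-- Let ρ c be the radius of the maximal even palindrome centred at c and
-- reach c = max_{d ≤ c} (d + ρ d) the rightmost end of those centred at or
-- before c.  reach is nondecreasing with reach 0 = 0 and reach (m-1) ≤ m, so
-- its m-1 increments, written in unary and separated by m-2 zeros, take at
-- most 2m-2 bits.  Conversely reach determines ρ, by induction on c: if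
-- c + t > reach (c-1), then t ≤ ρ c iff c + t ≤ reach c; otherwise
-- x[c..c+t-1] lies inside the palindrome centred at the d attaining
-- reach (c-1), and reflecting about d shows t ≤ ρ c iff t ≤ ρ (2d-c).
module Submission where

open import Defs
open import Data.Bool using (Bool; true; false)
open import Data.Fin using (toℕ)
open import Data.Fin.Properties using (toℕ<n)
open import Data.List using (List; []; _∷_; length; replicate; _++_)
open import Data.List.Properties using (length-++; length-replicate; ∷-injectiveʳ)
open import Data.Maybe using (just; nothing)
open import Data.Maybe.Properties using (just-injective)
open import Data.Nat
open import Data.Nat.Induction using (<-rec)
open import Data.Nat.Properties
open import Data.Nat.Tactic.RingSolver using (solve-∀)
open import Data.Product using (Σ; _×_; _,_; proj₁; proj₂; ∃-syntax; map₁)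
open import Data.Sum using (inj₁; inj₂)
open import Data.Vec using (Vec; toList)
open import Data.Vec.Properties using (tabulate-cong; length-toList)
open import Function using (_⇔_; mk⇔; Equivalence)
open import Function.Properties.Equivalence using () renaming (trans to ⇔-trans; sym to ⇔-sym)
open import Relation.Binary.PropositionalEquality
open import Relation.Binary.Definitions using (DecidableEquality)
open import Relation.Nullary using (¬_; yes; no; contradiction)

open Equivalence using (to; from)

∸-cancelʳ : ∀ {b} a n → b ≡ a + n → b ∸ n ≡ a
∸-cancelʳ a n refl = m+n∸n≡m a n

+-∸-shift : ∀ a k i → a + k ∸ suc (k + i) ≡ a ∸ suc i
+-∸-shift a k i = trans (cong₂ _∸_ (+-comm a k) (sym (+-suc k i))) ([m+n]∸[m+o]≡n∸o k a (suc i))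

≤⇔≤⇒≡ : ∀ {a b} → (∀ t → t ≤ a ⇔ t ≤ b) → a ≡ b
≤⇔≤⇒≡ {a} {b} h = ≤-antisym (to (h a) ≤-refl) (from (h b) ≤-refl)

>⇒≤⊔⇔≤ : ∀ {a b x} → a < x → x ≤ a ⊔ b ⇔ x ≤ b
>⇒≤⊔⇔≤ {a} {b} {x} a<x = mk⇔ below-right (λ x≤b → ≤-trans x≤b (m≤n⊔m a b))
  where
  below-right : x ≤ a ⊔ b → x ≤ b
  below-right x≤a⊔b with ⊔-sel a b
  ... | inj₁ a⊔b≡a = contradiction (subst (x ≤_) a⊔b≡a x≤a⊔b) (<⇒≱ a<x)
  ... | inj₂ a⊔b≡b = subst (x ≤_) a⊔b≡b x≤a⊔b

lookupM-just⇒< : ∀ {A : Set} (xs : List A) i {a} → lookupM xs i ≡ just a → i < length xs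
lookupM-just⇒< (_ ∷ _)  zero    _ = s≤s z≤n
lookupM-just⇒< (_ ∷ xs) (suc i) e = s≤s (lookupM-just⇒< xs i e)

lookupM-nothing⇒≥ : ∀ {A : Set} (xs : List A) i → lookupM xs i ≡ nothing → length xs ≤ i
lookupM-nothing⇒≥ []       _       _ = z≤n
lookupM-nothing⇒≥ (_ ∷ _)  zero    ()
lookupM-nothing⇒≥ (_ ∷ xs) (suc i) e = s≤s (lookupM-nothing⇒≥ xs i e)

module _ {A : Set} (xs : List A) where

  Palindromic : ℕ → ℕ → Set
  Palindromic c r = ∀ i → i < r → lookupM xs (c ∸ suc i) ≡ lookupM xs (c + i)

  record EvenPalAt (c r : ℕ) : Set where
    constructor evenPalAt
    field
      left-bound  : r ≤ c
      right-bound : c + r ≤ length xs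
      palindromic : Palindromic c r

  open EvenPalAt

  evenPalAt-≤ : ∀ {c r t} → t ≤ r → EvenPalAt c r → EvenPalAt c t
  evenPalAt-≤ t≤r (evenPalAt left right pal) =
    evenPalAt (≤-trans t≤r left) (≤-trans (+-monoʳ-≤ _ t≤r) right) (λ i i<t → pal i (<-≤-trans i<t t≤r))

  palindromic-extend : ∀ {c r} → Palindromic c r →
    lookupM xs (c ∸ suc r) ≡ lookupM xs (c + r) → Palindromic c (suc r)
  palindromic-extend pal eq i i<1+r with m≤n⇒m<n∨m≡n (≤-pred i<1+r)
  ... | inj₁ i<r  = pal i i<r
  ... | inj₂ refl = eq

  -- Reflection about the centre e + k maps the pair (e ∸ suc i, e + i) centred
  -- at e to the pair (c + i, c ∸ suc i) centred at c = e + k + k.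
  mirror-outer : ∀ {e k s} → Palindromic (e + k) s → ∀ i → k + i < s →
    lookupM xs (e ∸ suc i) ≡ lookupM xs (e + k + k + i)
  mirror-outer {e} {k} pal i lt = begin
    lookupM xs (e ∸ suc i)           ≡⟨ cong (lookupM xs) (sym (+-∸-shift e k i)) ⟩
    lookupM xs (e + k ∸ suc (k + i)) ≡⟨ pal (k + i) lt ⟩
    lookupM xs (e + k + (k + i))     ≡⟨ cong (lookupM xs) (sym (+-assoc (e + k) k i)) ⟩
    lookupM xs (e + k + k + i)       ∎
    where open ≡-Reasoning

  mirror-inner : ∀ {e k s} → Palindromic (e + k) s → ∀ i → k + i < s →
    lookupM xs (e + i) ≡ lookupM xs (e + k + k ∸ suc i)
  mirror-inner {e} {k} pal i lt with i <? k
  ... | yes i<k with m≤n⇒∃[o]m+o≡n i<k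
  ...   | j , refl = begin
    lookupM xs (e + i)             ≡⟨ cong (lookupM xs) (sym (∸-cancelʳ (e + i) (suc j) (regroupˡ e i j))) ⟩
    lookupM xs (e + k ∸ suc j)     ≡⟨ pal j (<-trans (s≤s (≤-trans (m≤n+m j i) (m≤m+n (i + j) i))) lt) ⟩
    lookupM xs (e + k + j)         ≡⟨ cong (lookupM xs) (sym (∸-cancelʳ (e + k + j) (suc i) (regroupʳ e i j))) ⟩
    lookupM xs (e + k + k ∸ suc i) ∎
    where
    open ≡-Reasoning
    regroupˡ : ∀ e i j → e + (suc i + j) ≡ e + i + suc j
    regroupˡ = solve-∀
    regroupʳ : ∀ e i j → e + (suc i + j) + (suc i + j) ≡ e + (suc i + j) + j + suc i
    regroupʳ = solve-∀
  mirror-inner {e} {k} pal i lt | no i≮k with m≤n⇒∃[o]m+o≡n (≮⇒≥ i≮k)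
  ...   | j , refl = begin
    lookupM xs (e + (k + j))             ≡⟨ cong (lookupM xs) (sym (+-assoc e k j)) ⟩
    lookupM xs (e + k + j)               ≡⟨ sym (pal j (≤-<-trans (≤-trans (m≤n+m j k) (m≤n+m (k + j) k)) lt)) ⟩
    lookupM xs (e + k ∸ suc j)           ≡⟨ cong (lookupM xs) (sym (+-∸-shift (e + k) k j)) ⟩
    lookupM xs (e + k + k ∸ suc (k + j)) ∎
    where open ≡-Reasoning

  palindromic-mirror : ∀ {e k s t} → Palindromic (e + k) s → k + t ≤ s →
    Palindromic (e + k + k) t ⇔ Palindromic e t
  palindromic-mirror {e} {k} {s} {t} pal k+t≤s = mk⇔
    (λ pc i i<t → trans (mirror-outer pal i (inside i<t))
                    (trans (sym (pc i i<t)) (sym (mirror-inner pal i (inside i<t)))))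
    (λ pe i i<t → trans (sym (mirror-inner pal i (inside i<t)))
                    (trans (sym (pe i i<t)) (mirror-outer pal i (inside i<t))))
    where
    inside : ∀ {i} → i < t → k + i < s
    inside i<t = <-≤-trans (+-monoʳ-< k i<t) k+t≤s

  evenPalAt-mirror : ∀ {e k s t} → EvenPalAt (e + k) s → k + t ≤ s →
    EvenPalAt (e + k + k) t ⇔ EvenPalAt e t
  evenPalAt-mirror {e} {k} {s} {t} (evenPalAt left right pal) k+t≤s = mk⇔
    (λ q → evenPalAt t≤e e+t≤len (to (palindromic-mirror pal k+t≤s) (palindromic q)))
    (λ q → evenPalAt t≤c c+t≤len (from (palindromic-mirror pal k+t≤s) (palindromic q)))
    where
    t≤e : t ≤ e
    t≤e = +-cancelˡ-≤ k t e (≤-trans k+t≤s (≤-trans left (≤-reflexive (+-comm e k))))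
    t≤c : t ≤ e + k + k
    t≤c = ≤-trans t≤e (≤-trans (m≤m+n e k) (m≤m+n (e + k) k))
    c+t≤len : e + k + k + t ≤ length xs
    c+t≤len = ≤-trans (≤-reflexive (+-assoc (e + k) k t)) (≤-trans (+-monoʳ-≤ (e + k) k+t≤s) right)
    e+t≤len : e + t ≤ length xs
    e+t≤len = ≤-trans (+-monoˡ-≤ t (≤-trans (m≤m+n e k) (m≤m+n (e + k) k))) c+t≤len

record IsEvenPalRadius (m : ℕ) (R : ℕ → ℕ) : Set where
  field
    radius≤centre  : ∀ c → c ≤ m → R c ≤ c
    centre+radius≤ : ∀ c → c ≤ m → c + R c ≤ m
    mirror         : ∀ {e d c k t} → e + k ≡ d → d + k ≡ c → c ≤ m →
                     k + t ≤ R d → t ≤ R c ⇔ t ≤ R e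

  radius-zero : R 0 ≡ 0
  radius-zero = n≤0⇒n≡0 (radius≤centre 0 z≤n)

module _ {A : Set} (_≟_ : DecidableEquality A) (xs : List A) where

  open EvenPalAt

  radius-maximal : ∀ c r k → length xs ≤ r + k → EvenPalAt xs c r →
    EvenPalAt xs c (radius _≟_ xs c r k) × ¬ EvenPalAt xs c (suc (radius _≟_ xs c r k))
  radius-maximal c r zero len≤r+0 p = p , λ q →
    n≮n r (≤-trans (m≤n+m (suc r) c) (≤-trans (right-bound q) (subst (length xs ≤_) (+-identityʳ r) len≤r+0)))
  radius-maximal c r (suc k) len≤ p with r <? c
  ... | no r≮c = p , λ q → r≮c (left-bound q)
  ... | yes r<c with lookupM xs (c ∸ suc r) in eˡ | lookupM xs (c + r) in eʳ
  ...   | just a | just b with a ≟ b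
  ...     | yes refl = radius-maximal c (suc r) k (subst (length xs ≤_) (+-suc r k) len≤)
                         (evenPalAt r<c (subst (_≤ length xs) (sym (+-suc c r)) (lookupM-just⇒< xs (c + r) eʳ))
                                    (palindromic-extend xs (palindromic p) (trans eˡ (sym eʳ))))
  ...     | no a≢b   = p , λ q → a≢b (just-injective (trans (sym eˡ) (trans (palindromic q r ≤-refl) eʳ)))
  radius-maximal c r (suc k) len≤ p | yes r<c | just a | nothing = p , λ q →
    <⇒≱ (subst (_≤ length xs) (+-suc c r) (right-bound q)) (lookupM-nothing⇒≥ xs (c + r) eʳ)
  radius-maximal c r (suc k) len≤ p | yes r<c | nothing | _ = p , λ q →
    <⇒≱ (<-≤-trans (∸-monoʳ-< {c} {suc r} {0} z<s r<c) (≤-trans (m≤m+n c (suc r)) (right-bound q)))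
        (lookupM-nothing⇒≥ xs (c ∸ suc r) eˡ)

  ≤radius⇔evenPalAt : ∀ {fuel c t} → length xs ≤ fuel → c ≤ length xs →
    t ≤ radius _≟_ xs c 0 fuel ⇔ EvenPalAt xs c t
  ≤radius⇔evenPalAt {fuel} {c} len≤fuel c≤len = mk⇔
    (λ t≤ρ → evenPalAt-≤ xs t≤ρ longest)
    (λ q → ≮⇒≥ (λ ρ<t → not-longer (evenPalAt-≤ xs ρ<t q)))
    where
    empty : EvenPalAt xs c 0
    empty = evenPalAt z≤n (subst (_≤ length xs) (sym (+-identityʳ c)) c≤len) (λ _ ())
    longest : EvenPalAt xs c (radius _≟_ xs c 0 fuel)
    longest = proj₁ (radius-maximal c 0 fuel len≤fuel empty)
    not-longer : ¬ EvenPalAt xs c (suc (radius _≟_ xs c 0 fuel))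
    not-longer = proj₂ (radius-maximal c 0 fuel len≤fuel empty)

  radius-isEvenPalRadius : ∀ {m} → length xs ≡ m → IsEvenPalRadius m (λ c → radius _≟_ xs c 0 m)
  radius-isEvenPalRadius refl = record
    { radius≤centre  = λ c c≤m → left-bound (longest c≤m)
    ; centre+radius≤ = λ c c≤m → right-bound (longest c≤m)
    ; mirror         = mirror
    }
    where
    longest : ∀ {c} → c ≤ length xs → EvenPalAt xs c (radius _≟_ xs c 0 (length xs))
    longest c≤len = to (≤radius⇔evenPalAt ≤-refl c≤len) ≤-refl
    mirror : ∀ {e d c k t} → e + k ≡ d → d + k ≡ c → c ≤ length xs →
             k + t ≤ radius _≟_ xs d 0 (length xs) →
             t ≤ radius _≟_ xs c 0 (length xs) ⇔ t ≤ radius _≟_ xs e 0 (length xs)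
    mirror {e} {k = k} refl refl c≤len k+t≤ρ =
      ⇔-trans (≤radius⇔evenPalAt ≤-refl c≤len)
        (⇔-trans (evenPalAt-mirror xs (longest d≤len) k+t≤ρ) (⇔-sym (≤radius⇔evenPalAt ≤-refl e≤len)))
      where
      d≤len : e + k ≤ length xs
      d≤len = ≤-trans (m≤m+n (e + k) k) c≤len
      e≤len : e ≤ length xs
      e≤len = ≤-trans (m≤m+n e k) d≤len

reach : (ℕ → ℕ) → ℕ → ℕ
reach R zero    = R 0
reach R (suc c) = reach R c ⊔ (suc c + R (suc c))

reach-mono : ∀ R c → reach R c ≤ reach R (suc c)
reach-mono R c = m≤m⊔n (reach R c) _

reach-attained : ∀ R c → ∃[ d ] d ≤ c × d + R d ≡ reach R c
reach-attained R zero = 0 , z≤n , refl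
reach-attained R (suc c) with ⊔-sel (reach R c) (suc c + R (suc c))
... | inj₁ eq = let d , d≤c , d+Rd≡ = reach-attained R c in d , m≤n⇒m≤1+n d≤c , trans d+Rd≡ (sym eq)
... | inj₂ eq = suc c , ≤-refl , sym eq

reach-beyond : ∀ R c {t} → reach R c < suc c + t → t ≤ R (suc c) ⇔ suc c + t ≤ reach R (suc c)
reach-beyond R c {t} beyond = ⇔-trans
  (mk⇔ (+-monoʳ-≤ (suc c)) (+-cancelˡ-≤ (suc c) t (R (suc c))))
  (⇔-sym (>⇒≤⊔⇔≤ beyond))

reach-≤ : ∀ {m R} → IsEvenPalRadius m R → ∀ c → c ≤ m → reach R c ≤ m
reach-≤ {m} {R} isR c c≤m = let d , d≤c , d+Rd≡ = reach-attained R c in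
  subst (_≤ m) d+Rd≡ (IsEvenPalRadius.centre+radius≤ isR d (≤-trans d≤c c≤m))

module _ {m R R′} (isR : IsEvenPalRadius m R) (isR′ : IsEvenPalRadius m R′) where

  private
    module R  = IsEvenPalRadius isR
    module R′ = IsEvenPalRadius isR′

  covered-≤-agrees : ∀ {d c t} → d < c → c < m → (∀ {c′} → c′ < c → R c′ ≡ R′ c′) →
    c + t ≤ d + R d → t ≤ R c ⇔ t ≤ R′ c
  covered-≤-agrees {d} {c} {t} d<c c<m agrees c+t≤ with m≤n⇒∃[o]m+o≡n (<⇒≤ d<c)
  ... | k , d+k≡c = ⇔-trans
    (subst (λ r → t ≤ R c ⇔ t ≤ r) (agrees e<c) (R.mirror e+k≡d d+k≡c (<⇒≤ c<m) k+t≤Rd))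
    (⇔-sym (R′.mirror e+k≡d d+k≡c (<⇒≤ c<m) (subst (k + t ≤_) (agrees d<c) k+t≤Rd)))
    where
    k+t≤Rd : k + t ≤ R d
    k+t≤Rd = +-cancelˡ-≤ d (k + t) (R d)
      (subst (_≤ d + R d) (trans (cong (_+ t) (sym d+k≡c)) (+-assoc d k t)) c+t≤)
    e : ℕ
    e = d ∸ k
    e+k≡d : e + k ≡ d
    e+k≡d = m∸n+n≡m (≤-trans (m≤m+n k t) (≤-trans k+t≤Rd (R.radius≤centre d (<⇒≤ (<-trans d<c c<m)))))
    e<c : e < c
    e<c = ≤-<-trans (m∸n≤m d k) d<c

  reach-determines-radius : (∀ c → c < m → reach R c ≡ reach R′ c) → ∀ c → c < m → R c ≡ R′ c
  reach-determines-radius same-reach = <-rec _ agrees-at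
    where
    agrees-at : ∀ c → (∀ {c′} → c′ < c → c′ < m → R c′ ≡ R′ c′) → c < m → R c ≡ R′ c
    agrees-at zero    _  _   = trans R.radius-zero (sym R′.radius-zero)
    agrees-at (suc c) ih c<m = ≤⇔≤⇒≡ ≤-agrees
      where
      agrees : ∀ {c′} → c′ < suc c → R c′ ≡ R′ c′
      agrees c′<c = ih c′<c (<-trans c′<c c<m)
      ≤-agrees : ∀ t → t ≤ R (suc c) ⇔ t ≤ R′ (suc c)
      ≤-agrees t with suc c + t ≤? reach R c
      ... | yes covered = let d , d≤c , d+Rd≡ = reach-attained R c in
        covered-≤-agrees (s≤s d≤c) c<m agrees (subst (suc c + t ≤_) (sym d+Rd≡) covered)
      ... | no uncovered = ⇔-trans
        (subst (λ E → t ≤ R (suc c) ⇔ suc c + t ≤ E) (same-reach (suc c) c<m) (reach-beyond R c beyond))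
        (⇔-sym (reach-beyond R′ c (subst (_< suc c + t) (same-reach c (<-trans (n<1+n c) c<m)) beyond)))
        where
        beyond : reach R c < suc c + t
        beyond = ≰⇒> uncovered

increments : (ℕ → ℕ) → ℕ → ℕ → List Bool
increments E c zero          = []
increments E c (suc zero)    = replicate (E (suc c) ∸ E c) true
increments E c (suc (suc k)) = replicate (E (suc c) ∸ E c) true ++ false ∷ increments E (suc c) (suc k)

module _ {E : ℕ → ℕ} (mono : ∀ c → E c ≤ E (suc c)) where

  length-increments : ∀ c k → length (increments E c k) + E c ≡ E (c + k) + pred k
  length-increments c zero = sym (trans (+-identityʳ _) (cong E (+-identityʳ c)))
  length-increments c (suc zero) = begin
    length (replicate (E (suc c) ∸ E c) true) + E c ≡⟨ cong (_+ E c) (length-replicate _) ⟩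
    E (suc c) ∸ E c + E c                           ≡⟨ m∸n+n≡m (mono c) ⟩
    E (suc c)                                       ≡⟨ sym (trans (+-identityʳ _) (cong E (+-comm c 1))) ⟩
    E (c + 1) + 0                                   ∎
    where open ≡-Reasoning
  length-increments c (suc (suc k)) = begin
    length (replicate δ true ++ false ∷ rest) + E c ≡⟨ cong (_+ E c) (length-++ (replicate δ true)) ⟩
    length (replicate δ true) + suc (length rest) + E c
      ≡⟨ cong (λ l → l + suc (length rest) + E c) (length-replicate δ) ⟩
    δ + suc (length rest) + E c                 ≡⟨ regroup δ (length rest) (E c) ⟩
    suc (length rest + (δ + E c))               ≡⟨ cong (λ n → suc (length rest + n)) (m∸n+n≡m (mono c)) ⟩
    suc (length rest + E (suc c))               ≡⟨ cong suc (length-increments (suc c) (suc k)) ⟩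
    suc (E (suc c + suc k) + k)                 ≡⟨ sym (+-suc _ k) ⟩
    E (suc c + suc k) + suc k                   ≡⟨ cong (λ n → E n + suc k) (sym (+-suc c (suc k))) ⟩
    E (c + suc (suc k)) + suc k                 ∎
    where
    open ≡-Reasoning
    δ : ℕ
    δ = E (suc c) ∸ E c
    rest : List Bool
    rest = increments E (suc c) (suc k)
    regroup : ∀ a b d → a + suc b + d ≡ suc (b + (a + d))
    regroup = solve-∀

  length-increments-≤ : E 0 ≡ 0 → ∀ n → E n ≤ suc n → length (increments E 0 n) ≤ 2 * suc n ∸ 2
  length-increments-≤ _ zero _ = z≤n
  length-increments-≤ E0≡0 (suc n) En≤ = begin
    length (increments E 0 (suc n))       ≡⟨ sym (+-identityʳ _) ⟩
    length (increments E 0 (suc n)) + 0   ≡⟨ cong (length (increments E 0 (suc n)) +_) (sym E0≡0) ⟩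
    length (increments E 0 (suc n)) + E 0 ≡⟨ length-increments 0 (suc n) ⟩
    E (suc n) + n                         ≤⟨ +-monoˡ-≤ n En≤ ⟩
    suc (suc n) + n                       ≡⟨ +-comm (suc (suc n)) n ⟩
    n + suc (suc n)                       ≡⟨ cong (λ l → n + suc (suc l)) (sym (+-identityʳ n)) ⟩
    2 * suc (suc n) ∸ 2                   ∎
    where open ≤-Reasoning

replicate-true-injective : ∀ u u′ → replicate u true ≡ replicate u′ true → u ≡ u′
replicate-true-injective u u′ eq = trans (sym (length-replicate u)) (trans (cong length eq) (length-replicate u′))

replicate-true-false-injective : ∀ u u′ {bs bs′ : List Bool} →
  replicate u true ++ false ∷ bs ≡ replicate u′ true ++ false ∷ bs′ → u ≡ u′ × bs ≡ bs′
replicate-true-false-injective zero    zero     eq = refl , ∷-injectiveʳ eq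
replicate-true-false-injective (suc u) (suc u′) eq =
  map₁ (cong suc) (replicate-true-false-injective u u′ (∷-injectiveʳ eq))

increments-uncons : ∀ {E F} c k → increments E c (suc k) ≡ increments F c (suc k) →
  E (suc c) ∸ E c ≡ F (suc c) ∸ F c × increments E (suc c) k ≡ increments F (suc c) k
increments-uncons c zero    eq = replicate-true-injective _ _ eq , refl
increments-uncons c (suc k) eq = replicate-true-false-injective _ _ eq

increments-injective : ∀ {E F} → (∀ c → E c ≤ E (suc c)) → (∀ c → F c ≤ F (suc c)) →
  ∀ c k → E c ≡ F c → increments E c k ≡ increments F c k → ∀ j → j ≤ k → E (c + j) ≡ F (c + j)
increments-injective {E} {F} _ _ c _ Ec≡Fc _ zero _ = subst (λ i → E i ≡ F i) (sym (+-identityʳ c)) Ec≡Fc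
increments-injective {E} {F} monoE monoF c (suc k) Ec≡Fc eq (suc j) (s≤s j≤k) =
  subst (λ i → E i ≡ F i) (sym (+-suc c j)) (increments-injective monoE monoF (suc c) k next tail-eq j j≤k)
  where
  δ-eq : E (suc c) ∸ E c ≡ F (suc c) ∸ F c
  δ-eq = proj₁ (increments-uncons c k eq)
  tail-eq : increments E (suc c) k ≡ increments F (suc c) k
  tail-eq = proj₂ (increments-uncons c k eq)
  next : E (suc c) ≡ F (suc c)
  next = begin
    E (suc c)             ≡⟨ sym (m∸n+n≡m (monoE c)) ⟩
    E (suc c) ∸ E c + E c ≡⟨ cong₂ _+_ δ-eq Ec≡Fc ⟩
    F (suc c) ∸ F c + F c ≡⟨ m∸n+n≡m (monoF c) ⟩
    F (suc c)             ∎
    where open ≡-Reasoning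

lemma2 : (A : Set) → (_≟_ : DecidableEquality A) → (m : ℕ) → 1 ≤ m →
  Σ (Vec A m → List Bool) (λ enc →
    ((x : Vec A m) → length (enc x) ≤ 2 * m ∸ 2) ×
    ((x y : Vec A m) → enc x ≡ enc y → MEPal _≟_ x ≡ MEPal _≟_ y))
lemma2 A _≟_ (suc n) _ = enc , enc-length , enc-determines
  where
  ρ : Vec A (suc n) → ℕ → ℕ
  ρ x c = radius _≟_ (toList x) c 0 (suc n)
  isρ : ∀ x → IsEvenPalRadius (suc n) (ρ x)
  isρ x = radius-isEvenPalRadius _≟_ (toList x) (length-toList x)
  enc : Vec A (suc n) → List Bool
  enc x = increments (reach (ρ x)) 0 n
  enc-length : ∀ x → length (enc x) ≤ 2 * suc n ∸ 2
  enc-length x = length-increments-≤ (reach-mono (ρ x)) (IsEvenPalRadius.radius-zero (isρ x)) n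
                   (reach-≤ (isρ x) n (n≤1+n n))
  enc-determines : ∀ x y → enc x ≡ enc y → MEPal _≟_ x ≡ MEPal _≟_ y
  enc-determines x y eq = tabulate-cong λ i →
    cong (2 *_) (reach-determines-radius (isρ x) (isρ y) same-reach (toℕ i) (toℕ<n i))
    where
    same-reach : ∀ c → c < suc n → reach (ρ x) c ≡ reach (ρ y) c
    same-reach c c<m = increments-injective (reach-mono (ρ x)) (reach-mono (ρ y)) 0 n
      (trans (IsEvenPalRadius.radius-zero (isρ x)) (sym (IsEvenPalRadius.radius-zero (isρ y)))) eq c (≤-pred c<m)
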